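{- Let $\Gamma$ be an abelian $p$-group (written multiplicatively) of rank $r$, where $p$ is a prime, and suppose that $X\subset\Gamma$ is a non-empty union of subgroups of $\Gamma$. Then $\langle X\rangle\subset X^r$.
   Context: The rank of a group is the minimal cardinality of a generating set. $X^r$ is the set of products of $r$ elements of $X$. -}

module Defs where

open import Level using (Level; _⊔_) renaming (suc to lsuc)
open import Data.Nat using (ℕ; _^_; _≤_)
open import Data.Fin using (Fin)
open import Data.Product using (Σ; ∃; _×_; _,_)
open import Relation.Unary using (Pred)
open import Algebra.Bundles using (AbelianGroup)

module GroupDefs {c ℓ : Level} (G : AbelianGroup c ℓ) where
  open AbelianGroup G

  pow : Carrier → ℕ → Carrier
  pow x ℕ.zero    = ε
  pow x (ℕ.suc n) = x ∙ pow x n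

  prod : (n : ℕ) → (Fin n → Carrier) → Carrier
  prod ℕ.zero    g = ε
  prod (ℕ.suc n) g = g Fin.zero ∙ prod n (λ i → g (Fin.suc i))

  RespectsEq : {ℓX : Level} → Pred Carrier ℓX → Set (c ⊔ ℓ ⊔ ℓX)
  RespectsEq X = ∀ {x y} → x ≈ y → X x → X y

  IsSubgroup : {ℓH : Level} → Pred Carrier ℓH → Set (c ⊔ ℓ ⊔ ℓH)
  IsSubgroup H = RespectsEq H
               × H ε
               × (∀ {x y} → H x → H y → H (x ∙ y))
               × (∀ {x} → H x → H (x ⁻¹))

  IsUnionOfSubgroups : {ℓX : Level} → Pred Carrier ℓX → Set (lsuc (c ⊔ ℓ ⊔ ℓX))
  IsUnionOfSubgroups {ℓX} X =
    RespectsEq X ×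
    (∀ {x} → X x → Σ (Pred Carrier (c ⊔ ℓ ⊔ ℓX)) λ H →
        IsSubgroup H × H x × (∀ {y} → H y → X y))

  data ⟨_⟩ {ℓX : Level} (X : Pred Carrier ℓX) : Pred Carrier (c ⊔ ℓ ⊔ ℓX) where
    gen  : ∀ {x} → X x → ⟨ X ⟩ x
    unit : ⟨ X ⟩ ε
    mul  : ∀ {x y} → ⟨ X ⟩ x → ⟨ X ⟩ y → ⟨ X ⟩ (x ∙ y)
    inv  : ∀ {x} → ⟨ X ⟩ x → ⟨ X ⟩ (x ⁻¹)
    resp : ∀ {x y} → x ≈ y → ⟨ X ⟩ x → ⟨ X ⟩ y

  Power : {ℓX : Level} → Pred Carrier ℓX → ℕ → Pred Carrier (c ⊔ ℓ ⊔ ℓX)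
  Power X r x = Σ (Fin r → Carrier) λ g → (∀ i → X (g i)) × (x ≈ prod r g)

  Range : {n : ℕ} → (Fin n → Carrier) → Pred Carrier ℓ
  Range {n} g x = ∃ λ (i : Fin n) → x ≈ g i

  Generates : {n : ℕ} → (Fin n → Carrier) → Set (c ⊔ ℓ)
  Generates g = ∀ x → ⟨ Range g ⟩ x

  HasRank : ℕ → Set (c ⊔ ℓ)
  HasRank r = (Σ (Fin r → Carrier) Generates)
            × (∀ m (g : Fin m → Carrier) → Generates g → r ≤ m)

  IsPGroup : ℕ → Set (c ⊔ ℓ)
  IsPGroup p = ∀ x → ∃ λ (k : ℕ) → pow x (p ^ k) ≈ ε

module Submission where

-- Write Z for the set of u all of whose powers lie in X; as X is a union of
-- subgroups, Z = X, and in this form it is visibly closed under powers and contains ε.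
-- Since Γ is finitely generated it has exponent N = p ^ K, hence inverses are positive
-- powers and every submonoid of Γ is a subgroup.
--
-- The heart of the proof is an elimination argument (Gaussian elimination over ℤ/p^K):
-- if u₁ … u_n ∈ Z all lie in ⟨g₁,…,g_m⟩·A for a submonoid A, then u₁⋯u_n ∈ Z^m·A.
-- Choose the pivot u₀ whose g₁-exponent has the smallest p-adic valuation (measured by
-- gcd with N); then every other u_j ∈ ⟨g₂,…,g_m⟩·A⟨u₀⟩, because modulo a prime power
-- the pivot exponent divides all the others.  Recursion absorbs u₀ into one factor.

open import Defs
open import Level using (Level; _⊔_)
open import Data.Nat using (ℕ)
open import Data.Nat.Primality using (Prime)
open import Data.Product using (∃; _,_)
open import Relation.Unary using (Pred)
open import Algebra.Bundles using (AbelianGroup)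

module Arithmetic where
  open import Data.Nat
  open import Data.Nat.Properties
  open import Data.Nat.Divisibility
  open import Data.Nat.GCD
  open import Data.Nat.Primality
  open import Data.Nat.Coprimality using (Coprime; coprime-divisor)
  open import Data.Nat.Tactic.RingSolver using (solve-∀)
  open import Data.Fin using (Fin; zero; suc)
  open import Data.Vec.Functional using (tail)
  open import Data.Product using (∃; _,_)
  open import Data.Sum using (inj₁; inj₂)
  open import Relation.Nullary using (yes; no; contradiction)
  open import Relation.Binary.PropositionalEquality

  ^-∣-^ : ∀ p {i j} → i ≤ j → p ^ i ∣ p ^ j
  ^-∣-^ p {i} {j} i≤j =
    subst (λ k → p ^ i ∣ p ^ k) (m+[n∸m]≡n i≤j)
      (subst (p ^ i ∣_) (sym (^-distribˡ-+-* p i (j ∸ i))) (m∣m*n (p ^ (j ∸ i))))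

  divisor-of-prime-power : ∀ {p} → Prime p → ∀ K {d} → d ∣ p ^ K → ∃ λ j → d ≡ p ^ j
  divisor-of-prime-power pp zero d∣1 = 0 , ∣1⇒≡1 d∣1
  divisor-of-prime-power {p} pp (suc K) {d} d∣p^K+1 with p ∣? d
  ... | yes (divides q refl) with divisor-of-prime-power pp K q∣p^K
    where
    q∣p^K : q ∣ p ^ K
    q∣p^K = *-cancelʳ-∣ p {{prime⇒nonZero pp}} (subst (q * p ∣_) (*-comm p (p ^ K)) d∣p^K+1)
  ...   | j , refl = suc j , *-comm (p ^ j) p
  divisor-of-prime-power {p} pp (suc K) {d} d∣p^K+1 | no p∤d =
    divisor-of-prime-power pp K (coprime-divisor d⊥p d∣p^K+1)
    where
    d⊥p : Coprime d p
    d⊥p {i} (i∣d , i∣p) with prime⇒irreducible pp i∣p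
    ... | inj₁ i≡1 = i≡1
    ... | inj₂ refl = contradiction i∣d p∤d

  prime-power-divisors-chain : ∀ {p K a b} → Prime p → a ∣ p ^ K → b ∣ p ^ K → a ≤ b → a ∣ b
  prime-power-divisors-chain {p} {K} pp a∣p^K b∣p^K a≤b
    with divisor-of-prime-power pp K a∣p^K | divisor-of-prime-power pp K b∣p^K
  ... | i , refl | j , refl with i ≤? j
  ...   | yes i≤j = ^-∣-^ p i≤j
  ...   | no i≰j = contradiction a≤b (<⇒≱ (^-monoʳ-< p 1<p (≰⇒> i≰j)))
    where
    1<p : 1 < p
    1<p = nonTrivial⇒n>1 p {{prime⇒nonTrivial pp}}

  private
    +-step : ∀ q g a M x → q * g + q * a * M * x ≡ q * g + q * M * (a * x)
    +-step = solve-∀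
    +-collect : ∀ q g M b → q * g + q * M * (g + b * suc M) ≡ (q * g + q * M * b) * suc M
    +-collect = solve-∀
    -+-step : ∀ q g a x → q * g + q * a * x ≡ q * (g + a * x)
    -+-step = solve-∀

  linear-congruence : ∀ M x y → gcd x (suc M) ∣ y → ∃ λ d → suc M ∣ y + d * x
  linear-congruence M x _ (divides q refl) with Bézout.identity (gcd-GCD x (suc M))
  ... | Bézout.+- a b g+bN≡ax = q * a * M , divides (q * g + q * M * b) (begin
    q * g + q * a * M * x         ≡⟨ +-step q g a M x ⟩
    q * g + q * M * (a * x)       ≡⟨ cong (λ z → q * g + q * M * z) (sym g+bN≡ax) ⟩
    q * g + q * M * (g + b * N)   ≡⟨ +-collect q g M b ⟩
    (q * g + q * M * b) * N       ∎)
    where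
    open ≡-Reasoning
    N = suc M
    g = gcd x N
  ... | Bézout.-+ a b g+ax≡bN = q * a , divides (q * b) (begin
    q * g + q * a * x   ≡⟨ -+-step q g a x ⟩
    q * (g + a * x)     ≡⟨ cong (q *_) g+ax≡bN ⟩
    q * (b * suc M)     ≡⟨ *-assoc q b (suc M) ⟨
    q * b * suc M       ∎)
    where
    open ≡-Reasoning
    g = gcd x (suc M)

  prime-power-elimination : ∀ {p K M} → Prime p → p ^ K ≡ suc M → ∀ x y →
    gcd x (suc M) ≤ gcd y (suc M) → ∃ λ d → suc M ∣ y + d * x
  prime-power-elimination {p} {K} {M} pp p^K≡N x y gx≤gy =
    linear-congruence M x y
      (∣-trans (prime-power-divisors-chain {K = K} pp (divides-N x) (divides-N y) gx≤gy)
               (gcd[m,n]∣m y (suc M)))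
    where
    divides-N : ∀ z → gcd z (suc M) ∣ p ^ K
    divides-N z = subst (gcd z (suc M) ∣_) (sym p^K≡N) (gcd[m,n]∣n z (suc M))

  argmin : ∀ n (key : Fin (suc n) → ℕ) → ∃ λ i → ∀ j → key i ≤ key j
  argmin zero key = zero , λ { zero → ≤-refl }
  argmin (suc n) key with argmin n (tail key)
  ... | i , minimal with key zero ≤? key (suc i)
  ...   | yes k₀≤ = zero , λ { zero → ≤-refl ; (suc j) → ≤-trans k₀≤ (minimal j) }
  ...   | no k₀≰ = suc i , λ { zero → <⇒≤ (≰⇒> k₀≰) ; (suc j) → minimal j }

module GroupTheory {c ℓ : Level} (G : AbelianGroup c ℓ) where
  open AbelianGroup G
  open GroupDefs G
  open import Data.Nat using (zero; suc; _+_; _*_; _^_; _≤_; pred)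
  open import Data.Nat.Properties using (suc-pred; m^n≢0; *-comm; m≤m+n; m≤n+m)
  open import Data.Nat.Divisibility using (_∣_; divides; m∣m*n)
  open import Data.Nat.GCD using (gcd)
  open import Data.Nat.Primality using (prime⇒nonZero)
  open import Data.Fin using (Fin; zero; suc; punchIn)
  open import Data.Vec.Functional using (_∷_; tail; removeAt)
  open import Data.Product using (∃; ∃₂; _×_; _,_)
  import Relation.Binary.PropositionalEquality as ≡
  open import Relation.Binary.Reasoning.Setoid setoid
  open import Algebra.Properties.AbelianGroup G using (⁻¹-∙-comm)
  open import Algebra.Properties.Group group using (ε⁻¹≈ε; inverseʳ-unique)
  open import Algebra.Properties.CommutativeSemigroup commutativeSemigroup using (interchange)
  open import Algebra.Solver.CommutativeMonoid commutativeMonoid using (solve; _⊕_; _⊜_)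
  import Algebra.Properties.CommutativeMonoid.Mult commutativeMonoid as Mult
  import Algebra.Properties.CommutativeMonoid.Sum commutativeMonoid as Sum
  open Arithmetic using (^-∣-^; prime-power-elimination; argmin)

  pow≡× : ∀ x n → pow x n ≡.≡ n Mult.× x
  pow≡× x zero = ≡.refl
  pow≡× x (suc n) = ≡.cong (x ∙_) (pow≡× x n)

  pow-cong : ∀ n {x y} → x ≈ y → pow x n ≈ pow y n
  pow-cong n {x} {y} x≈y rewrite pow≡× x n | pow≡× y n = Mult.×-congʳ n x≈y

  pow-+ : ∀ x m n → pow x (m + n) ≈ pow x m ∙ pow x n
  pow-+ x m n rewrite pow≡× x (m + n) | pow≡× x m | pow≡× x n = Mult.×-homo-+ x m n

  pow-∙ : ∀ x y n → pow (x ∙ y) n ≈ pow x n ∙ pow y n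
  pow-∙ x y n rewrite pow≡× (x ∙ y) n | pow≡× x n | pow≡× y n = Mult.×-distrib-+ x y n

  pow-* : ∀ x m n → pow x (m * n) ≈ pow (pow x m) n
  pow-* x m n rewrite pow≡× (pow x m) n | pow≡× x m | pow≡× x (m * n) =
    trans (Mult.×-congˡ (*-comm m n)) (sym (Mult.×-assocˡ x n m))

  pow-ε : ∀ n → pow ε n ≈ ε
  pow-ε zero = refl
  pow-ε (suc n) = trans (identityˡ _) (pow-ε n)

  pow-⁻¹ : ∀ x n → pow (x ⁻¹) n ≈ pow x n ⁻¹
  pow-⁻¹ x zero = sym ε⁻¹≈ε
  pow-⁻¹ x (suc n) = trans (∙-congˡ (pow-⁻¹ x n)) (⁻¹-∙-comm x (pow x n))

  prod≡sum : ∀ n f → prod n f ≡.≡ Sum.sum f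
  prod≡sum zero f = ≡.refl
  prod≡sum (suc n) f = ≡.cong (f zero ∙_) (prod≡sum n (tail f))

  prod-cong : ∀ n {f g} → (∀ i → f i ≈ g i) → prod n f ≈ prod n g
  prod-cong n {f} {g} f≈g rewrite prod≡sum n f | prod≡sum n g = Sum.sum-cong-≋ f≈g

  prod-∙ : ∀ n f g → prod n (λ i → f i ∙ g i) ≈ prod n f ∙ prod n g
  prod-∙ n f g rewrite prod≡sum n (λ i → f i ∙ g i) | prod≡sum n f | prod≡sum n g =
    Sum.∑-distrib-+ f g

  prod-ε : ∀ n → prod n (λ _ → ε) ≈ ε
  prod-ε n rewrite prod≡sum n (λ _ → ε) = Sum.sum-replicate-zero n

  prod-remove : ∀ n f i → prod (suc n) f ≈ f i ∙ prod n (removeAt f i)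
  prod-remove n f i rewrite prod≡sum (suc n) f | prod≡sum n (removeAt f i) = Sum.sum-remove f

  combination : ∀ {m} → (Fin m → Carrier) → (Fin m → ℕ) → Carrier
  combination {m} g a = prod m (λ i → pow (g i) (a i))

  combination-zero : ∀ {m} (g : Fin m → Carrier) → combination g (λ _ → 0) ≈ ε
  combination-zero {m} g = prod-ε m

  combination-+ : ∀ {m} g (a b : Fin m → ℕ) →
    combination g (λ i → a i + b i) ≈ combination g a ∙ combination g b
  combination-+ {m} g a b =
    trans (prod-cong m (λ i → pow-+ (g i) (a i) (b i))) (prod-∙ m _ _)

  combination-scale : ∀ {m} g (a : Fin m → ℕ) d →
    combination g (λ i → d * a i) ≈ pow (combination g a) d
  combination-scale g a zero = combination-zero g
  combination-scale g a (suc d) =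
    trans (combination-+ g a (λ i → d * a i)) (∙-congˡ (combination-scale g a d))

  basis : ∀ {m} → Fin m → Fin m → ℕ
  basis zero zero = 1
  basis zero (suc _) = 0
  basis (suc _) zero = 0
  basis (suc i) (suc j) = basis i j

  combination-basis : ∀ {m} g (i : Fin m) → combination g (basis i) ≈ g i
  combination-basis g zero =
    trans (∙-cong (identityʳ (g zero)) (combination-zero (tail g))) (identityʳ (g zero))
  combination-basis g (suc i) = trans (identityˡ _) (combination-basis (tail g) i)

  record IsSubmonoid {ℓH : Level} (H : Pred Carrier ℓH) : Set (c ⊔ ℓ ⊔ ℓH) where
    field
      respects : RespectsEq H
      ε∈ : H ε
      ∙-closed : ∀ {x y} → H x → H y → H (x ∙ y)
  open IsSubmonoid

  pow-closed : ∀ {ℓH} {H : Pred Carrier ℓH} → IsSubmonoid H → ∀ n {x} → H x → H (pow x n)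
  pow-closed H zero x∈H = ε∈ H
  pow-closed H (suc n) x∈H = ∙-closed H x∈H (pow-closed H n x∈H)

  prod-closed : ∀ {ℓH} {H : Pred Carrier ℓH} → IsSubmonoid H →
    ∀ n {f} → (∀ i → H (f i)) → H (prod n f)
  prod-closed H zero f∈H = ε∈ H
  prod-closed H (suc n) f∈H = ∙-closed H (f∈H zero) (prod-closed H n (λ i → f∈H (suc i)))

  ⟨⟩-least : ∀ {ℓS ℓH} {S : Pred Carrier ℓS} {H : Pred Carrier ℓH} → IsSubgroup H →
    (∀ {x} → S x → H x) → ∀ {x} → ⟨ S ⟩ x → H x
  ⟨⟩-least H S⊆H (gen x∈S) = S⊆H x∈S
  ⟨⟩-least (_ , ε∈H , _ , _) S⊆H unit = ε∈H
  ⟨⟩-least H@(_ , _ , ∙-closedH , _) S⊆H (mul x y) =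
    ∙-closedH (⟨⟩-least H S⊆H x) (⟨⟩-least H S⊆H y)
  ⟨⟩-least H@(_ , _ , _ , ⁻¹-closedH) S⊆H (inv x) = ⁻¹-closedH (⟨⟩-least H S⊆H x)
  ⟨⟩-least H@(respH , _ , _ , _) S⊆H (resp x≈y x) = respH x≈y (⟨⟩-least H S⊆H x)

  _·_ : ∀ {ℓP ℓQ} → Pred Carrier ℓP → Pred Carrier ℓQ → Pred Carrier (c ⊔ ℓ ⊔ ℓP ⊔ ℓQ)
  (P · Q) y = ∃₂ λ z t → P z × Q t × y ≈ z ∙ t

  ·-respects : ∀ {ℓP ℓQ} {P : Pred Carrier ℓP} {Q : Pred Carrier ℓQ} → RespectsEq (P · Q)
  ·-respects x≈y (z , t , z∈P , t∈Q , x≈zt) = z , t , z∈P , t∈Q , trans (sym x≈y) x≈zt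

  ·-submonoid : ∀ {ℓP ℓQ} {P : Pred Carrier ℓP} {Q : Pred Carrier ℓQ} →
    IsSubmonoid P → IsSubmonoid Q → IsSubmonoid (P · Q)
  ·-submonoid P Q = record
    { respects = ·-respects
    ; ε∈ = ε , ε , ε∈ P , ε∈ Q , sym (identityˡ ε)
    ; ∙-closed = λ { (z , t , z∈P , t∈Q , x≈zt) (z′ , t′ , z′∈P , t′∈Q , y≈z′t′) →
        z ∙ z′ , t ∙ t′ , ∙-closed P z∈P z′∈P , ∙-closed Q t∈Q t′∈Q ,
        trans (∙-cong x≈zt y≈z′t′) (interchange z t z′ t′) }
    }

  Powers : Carrier → Pred Carrier ℓ
  Powers u z = ∃ λ e → z ≈ pow u e

  powers-submonoid : ∀ u → IsSubmonoid (Powers u)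
  powers-submonoid u = record
    { respects = λ { x≈y (e , x≈uᵉ) → e , trans (sym x≈y) x≈uᵉ }
    ; ε∈ = 0 , refl
    ; ∙-closed = λ { (e , x≈uᵉ) (e′ , y≈uᵉ′) →
        e + e′ , trans (∙-cong x≈uᵉ y≈uᵉ′) (sym (pow-+ u e e′)) }
    }

  Trivial : Pred Carrier ℓ
  Trivial z = z ≈ ε

  trivial-submonoid : IsSubmonoid Trivial
  trivial-submonoid = record
    { respects = λ x≈y x≈ε → trans (sym x≈y) x≈ε
    ; ε∈ = refl
    ; ∙-closed = λ x≈ε y≈ε → trans (∙-cong x≈ε y≈ε) (identityˡ ε)
    }

  Killed : ℕ → Pred Carrier ℓ
  Killed n x = pow x n ≈ ε

  killed-subgroup : ∀ n → IsSubgroup (Killed n)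
  killed-subgroup n =
    (λ {x} {y} x≈y xⁿ≈ε → trans (pow-cong n (sym x≈y)) xⁿ≈ε) ,
    pow-ε n ,
    (λ {x} {y} xⁿ≈ε yⁿ≈ε → trans (pow-∙ x y n) (trans (∙-cong xⁿ≈ε yⁿ≈ε) (identityˡ ε))) ,
    (λ {x} xⁿ≈ε → trans (pow-⁻¹ x n) (trans (⁻¹-cong xⁿ≈ε) ε⁻¹≈ε))

  killed-∣ : ∀ {a b x} → a ∣ b → Killed a x → Killed b x
  killed-∣ {a} {x = x} (divides q ≡.refl) xᵃ≈ε = begin
    pow x (q * a)     ≡⟨ ≡.cong (pow x) (*-comm q a) ⟩
    pow x (a * q)     ≈⟨ pow-* x a q ⟩
    pow (pow x a) q   ≈⟨ pow-cong q xᵃ≈ε ⟩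
    pow ε q           ≈⟨ pow-ε q ⟩
    ε                 ∎

  common-exponent : ∀ {p} → IsPGroup p → ∀ n (h : Fin n → Carrier) →
    ∃ λ K → ∀ i → Killed (p ^ K) (h i)
  common-exponent pgroup zero h = 0 , λ ()
  common-exponent {p} pgroup (suc n) h with pgroup (h zero) | common-exponent pgroup n (tail h)
  ... | k , h₀-killed | K , tail-killed = k + K , λ
    { zero → killed-∣ (^-∣-^ p (m≤m+n k K)) h₀-killed
    ; (suc i) → killed-∣ (^-∣-^ p (m≤n+m K k)) (tail-killed i) }

  exponent-of-generated : ∀ {m n} {h : Fin m → Carrier} → Generates h →
    (∀ i → Killed n (h i)) → ∀ x → Killed n x
  exponent-of-generated {n = n} {h} generates h-killed x =
    ⟨⟩-least (killed-subgroup n)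
      (λ { (i , y≈hᵢ) → trans (pow-cong n y≈hᵢ) (h-killed i) }) (generates x)

  finite-exponent : ∀ {p r} {h : Fin r → Carrier} → Prime p → IsPGroup p → Generates h →
    ∃₂ λ K M → p ^ K ≡.≡ suc M × (∀ x → pow x (suc M) ≈ ε)
  finite-exponent {p} {r} {h} p-prime pgroup generates with common-exponent pgroup r h
  ... | K , h-killed = K , pred (p ^ K) , ≡.sym p^K≡N ,
    λ x → ≡.subst (λ n → pow x n ≈ ε) (≡.sym p^K≡N)
            (exponent-of-generated {n = p ^ K} generates h-killed x)
    where
    p^K≡N : suc (pred (p ^ K)) ≡.≡ p ^ K
    p^K≡N = suc-pred (p ^ K) {{m^n≢0 p K {{prime⇒nonZero p-prime}}}}

  CyclicIn : ∀ {ℓX} → Pred Carrier ℓX → Pred Carrier ℓX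
  CyclicIn X u = ∀ n → X (pow u n)

  cyclicIn-pow : ∀ {ℓX} {X : Pred Carrier ℓX} → RespectsEq X →
    ∀ {u} n → CyclicIn X u → CyclicIn X (pow u n)
  cyclicIn-pow X-resp {u} n u∈Z k = X-resp (pow-* u n k) (u∈Z (n * k))

  union-of-subgroups⇒cyclicIn : ∀ {ℓX} {X : Pred Carrier ℓX} → IsUnionOfSubgroups X →
    ∀ {x} → X x → CyclicIn X x
  union-of-subgroups⇒cyclicIn (_ , covered) x∈X with covered x∈X
  ... | H , (_ , ε∈H , ∙-closedH , _) , x∈H , H⊆X = λ n → H⊆X (powers∈H n)
    where
    powers∈H : ∀ n → H (pow _ n)
    powers∈H zero = ε∈H
    powers∈H (suc n) = ∙-closedH x∈H (powers∈H n)

  cyclicIn⇒member : ∀ {ℓX} {X : Pred Carrier ℓX} → RespectsEq X → ∀ {u} → CyclicIn X u → X u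
  cyclicIn⇒member X-resp {u} u∈Z = X-resp (identityʳ u) (u∈Z 1)

  cyclicIn-ε : ∀ {ℓX} {X : Pred Carrier ℓX} → RespectsEq X → ∀ {u} → CyclicIn X u → CyclicIn X ε
  cyclicIn-ε X-resp u∈Z n = X-resp (sym (pow-ε n)) (u∈Z 0)

  Power-respects : ∀ {ℓΦ} {Φ : Pred Carrier ℓΦ} {m} → RespectsEq (Power Φ m)
  Power-respects x≈y (v , v∈Φ , x≈v) = v , v∈Φ , trans (sym x≈y) x≈v

  Power-mono : ∀ {ℓΦ ℓΨ} {Φ : Pred Carrier ℓΦ} {Ψ : Pred Carrier ℓΨ} →
    (∀ {x} → Φ x → Ψ x) → ∀ {m y} → Power Φ m y → Power Ψ m y
  Power-mono Φ⊆Ψ (v , v∈Φ , y≈v) = v , (λ i → Φ⊆Ψ (v∈Φ i)) , y≈v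

  module WithExponent (M : ℕ) (exponent : ∀ x → pow x (suc M) ≈ ε) where

    N : ℕ
    N = suc M

    inverse-as-power : ∀ x → x ⁻¹ ≈ pow x M
    inverse-as-power x = sym (inverseʳ-unique x (pow x M) (exponent x))

    submonoid⇒subgroup : ∀ {ℓH} {H : Pred Carrier ℓH} → IsSubmonoid H → IsSubgroup H
    submonoid⇒subgroup H =
      respects H , ε∈ H , ∙-closed H ,
      (λ {x} x∈H → respects H (sym (inverse-as-power x)) (pow-closed H M x∈H))

    power-cancel : ∀ x d → pow x d ∙ pow x (M * d) ≈ ε
    power-cancel x d = trans (sym (pow-+ x d (M * d))) (killed-∣ {N} (m∣m*n d) (exponent x))

    drop-leading : ∀ {m} (g : Fin (suc m) → Carrier) a → N ∣ a zero →
      combination g a ≈ combination (tail g) (tail a)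
    drop-leading g a N∣a₀ =
      trans (∙-congʳ (killed-∣ N∣a₀ (exponent (g zero)))) (identityˡ _)

    record Span {m} (g : Fin m → Carrier) (y : Carrier) : Set ℓ where
      constructor span
      field
        exponents : Fin m → ℕ
        expansion : y ≈ combination g exponents

    span-submonoid : ∀ {m} (g : Fin m → Carrier) → IsSubmonoid (Span g)
    span-submonoid g = record
      { respects = λ { x≈y (span a x≈ga) → span a (trans (sym x≈y) x≈ga) }
      ; ε∈ = span (λ _ → 0) (sym (combination-zero g))
      ; ∙-closed = λ { (span a x≈ga) (span b y≈gb) →
          span (λ i → a i + b i) (trans (∙-cong x≈ga y≈gb) (sym (combination-+ g a b))) }
      }

    spans-everything : ∀ {m} {h : Fin m → Carrier} → Generates h → ∀ y → Span h y
    spans-everything {h = h} generates y =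
      ⟨⟩-least (submonoid⇒subgroup (span-submonoid h))
        (λ { (i , x≈hᵢ) → span (basis i) (trans x≈hᵢ (sym (combination-basis h i))) })
        (generates y)

    span-empty : ∀ {ℓA} {A : Pred Carrier ℓA} {g : Fin 0 → Carrier} → IsSubmonoid A →
      ∀ {u} → (Span g · A) u → A u
    span-empty A (z , t , span _ z≈ε , t∈A , u≈zt) =
      respects A (sym (trans u≈zt (trans (∙-congʳ z≈ε) (identityˡ t)))) t∈A

    leading : ∀ {m ℓA} {A : Pred Carrier ℓA} {g : Fin (suc m) → Carrier} {u} →
      (Span g · A) u → ℕ
    leading (_ , _ , span a _ , _) = a zero

    module Elimination {p K : ℕ} (p-prime : Prime p) (p^K≡N : p ^ K ≡.≡ N)
      {ℓZ} (Z : Pred Carrier ℓZ) (Z-pow : ∀ {u} n → Z u → Z (pow u n)) (Z-ε : Z ε) where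

      -- Pivot step: if the pivot u₀ has a leading exponent of smallest valuation, any
      -- other u ∈ ⟨g⟩·A lies in ⟨g₂,…,g_m⟩·(A·⟨u₀⟩), by multiplying u with u₀^d.
      eliminate : ∀ {m ℓA} {A : Pred Carrier ℓA} {g : Fin (suc m) → Carrier} {u₀ u} →
        IsSubmonoid A → (w₀ : (Span g · A) u₀) (w : (Span g · A) u) →
        gcd (leading w₀) N ≤ gcd (leading w) N → (Span (tail g) · (A · Powers u₀)) u
      eliminate {g = g} {u₀} {u} A (z₀ , t₀ , span a₀ z₀≈ , t₀∈A , u₀≈)
                                  (z , t , span a z≈ , t∈A , u≈) valuation≤
        with prime-power-elimination {K = K} p-prime p^K≡N (a₀ zero) (a zero) valuation≤
      ... | d , N∣ =
        combination (tail g) (tail b) , t ∙ pow t₀ d ∙ pow u₀ (M * d) ,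
        span (tail b) refl ,
        (t ∙ pow t₀ d , pow u₀ (M * d) , ∙-closed A t∈A (pow-closed A d t₀∈A) ,
         (M * d , refl) , refl) ,
        (begin
          u                                              ≈⟨ identityʳ u ⟨
          u ∙ ε                                          ≈⟨ ∙-congˡ (power-cancel u₀ d) ⟨
          u ∙ (pow u₀ d ∙ pow u₀ (M * d))                ≈⟨ assoc u _ _ ⟨
          u ∙ pow u₀ d ∙ pow u₀ (M * d)                  ≈⟨ ∙-congʳ shifted ⟩
          combination (tail g) (tail b) ∙ (t ∙ pow t₀ d) ∙ pow u₀ (M * d)
                                                         ≈⟨ assoc _ _ _ ⟩
          combination (tail g) (tail b) ∙ (t ∙ pow t₀ d ∙ pow u₀ (M * d)) ∎)
        where
        b : Fin (suc _) → ℕ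
        b i = a i + d * a₀ i

        -- u·u₀^d has leading exponent a + d·a₀ ≡ 0 (mod N), so g₁ drops out.
        shifted : u ∙ pow u₀ d ≈ combination (tail g) (tail b) ∙ (t ∙ pow t₀ d)
        shifted = begin
          u ∙ pow u₀ d
            ≈⟨ ∙-cong (trans u≈ (∙-congʳ z≈)) (pow-cong d (trans u₀≈ (∙-congʳ z₀≈))) ⟩
          combination g a ∙ t ∙ pow (combination g a₀ ∙ t₀) d
            ≈⟨ ∙-congˡ (pow-∙ _ t₀ d) ⟩
          combination g a ∙ t ∙ (pow (combination g a₀) d ∙ pow t₀ d)
            ≈⟨ interchange _ t _ _ ⟩
          combination g a ∙ pow (combination g a₀) d ∙ (t ∙ pow t₀ d)
            ≈⟨ ∙-congʳ (∙-congˡ (combination-scale g a₀ d)) ⟨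
          combination g a ∙ combination g (λ i → d * a₀ i) ∙ (t ∙ pow t₀ d)
            ≈⟨ ∙-congʳ (combination-+ g a (λ i → d * a₀ i)) ⟨
          combination g b ∙ (t ∙ pow t₀ d)
            ≈⟨ ∙-congʳ (drop-leading g b N∣) ⟩
          combination (tail g) (tail b) ∙ (t ∙ pow t₀ d)
            ∎

      ε∈Zᵐ : ∀ m → Power Z m ε
      ε∈Zᵐ m = (λ _ → ε) , (λ _ → Z-ε) , sym (prod-ε m)

      -- The pivot u₀ joins the Z-factors, its powers leaving the remainder.
      absorb-pivot : ∀ {m ℓA} {A : Pred Carrier ℓA} {u₀ y} → Z u₀ →
        (Power Z m · (A · Powers u₀)) y → (Power Z (suc m) · A) (u₀ ∙ y)
      absorb-pivot {u₀ = u₀} {y} u₀∈Z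
        (z , t , (v , v∈Z , z≈v) , (a , w , a∈A , (e , w≈u₀ᵉ) , t≈aw) , y≈zt) =
        pow u₀ (suc e) ∙ z , a ,
        (pow u₀ (suc e) ∷ v , (λ { zero → Z-pow (suc e) u₀∈Z ; (suc i) → v∈Z i }) , ∙-congˡ z≈v) ,
        a∈A ,
        (begin
          u₀ ∙ y
            ≈⟨ ∙-congˡ (trans y≈zt (∙-congˡ (trans t≈aw (∙-congˡ w≈u₀ᵉ)))) ⟩
          u₀ ∙ (z ∙ (a ∙ pow u₀ e))
            ≈⟨ solve 4 (λ x y z w → x ⊕ (y ⊕ (z ⊕ w)) ⊜ ((x ⊕ w) ⊕ y) ⊕ z) refl u₀ z a (pow u₀ e) ⟩
          pow u₀ (suc e) ∙ z ∙ a
            ∎)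

      elimination : ∀ m {ℓA} {A : Pred Carrier ℓA} → IsSubmonoid A → (g : Fin m → Carrier) →
        ∀ n (u : Fin n → Carrier) → (∀ i → Z (u i)) → (∀ i → (Span g · A) (u i)) →
        (Power Z m · A) (prod n u)
      elimination zero A g n u u∈Z u∈span =
        ε , prod n u , ε∈Zᵐ 0 , prod-closed A n (λ i → span-empty A (u∈span i)) , sym (identityˡ _)
      elimination (suc m) A g zero u u∈Z u∈span =
        ε , ε , ε∈Zᵐ (suc m) , ε∈ A , sym (identityˡ ε)
      elimination (suc m) A g (suc n) u u∈Z u∈span
        with argmin n (λ i → gcd (leading {g = g} (u∈span i)) N)
      ... | i₀ , minimal =
        ·-respects (sym (prod-remove n u i₀))
          (absorb-pivot (u∈Z i₀)
            (elimination m (·-submonoid A (powers-submonoid (u i₀))) (tail g) n (removeAt u i₀)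
              (λ j → u∈Z (punchIn i₀ j))
              (λ j → eliminate {g = g} A (u∈span i₀) (u∈span (punchIn i₀ j))
                                 (minimal (punchIn i₀ j)))))

      left-multiplication : ∀ {r} {h : Fin r → Carrier} → Generates h →
        ∀ {u y} → Z u → Power Z r y → Power Z r (u ∙ y)
      left-multiplication {r} {h} generates {u} u∈Z (v , v∈Z , y≈v)
        with elimination r trivial-submonoid h (suc r) (u ∷ v)
               (λ { zero → u∈Z ; (suc i) → v∈Z i })
               (λ i → _ , ε , spans-everything generates _ , refl , sym (identityʳ _))
      ... | z , t , (w , w∈Z , z≈w) , t≈ε , uv≈zt =
        w , w∈Z , trans (∙-congˡ y≈v) (trans uv≈zt (trans (∙-congˡ t≈ε) (trans (identityʳ z) z≈w)))

      Zʳ-submonoid : ∀ {r} {h : Fin r → Carrier} → Generates h → IsSubmonoid (Power Z r)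
      Zʳ-submonoid {r} generates = record
        { respects = Power-respects {Φ = Z}
        ; ε∈ = ε∈Zᵐ r
        ; ∙-closed = λ { (v , v∈Z , x≈v) y∈Zʳ →
            Power-respects {Φ = Z} (∙-congʳ (sym x≈v)) (absorb-product _ v v∈Z y∈Zʳ) }
        }
        where
        absorb-product : ∀ n (v : Fin n → Carrier) → (∀ i → Z (v i)) →
          ∀ {y} → Power Z r y → Power Z r (prod n v ∙ y)
        absorb-product zero v v∈Z {y} y∈Zʳ = Power-respects {Φ = Z} (sym (identityˡ y)) y∈Zʳ
        absorb-product (suc n) v v∈Z y∈Zʳ =
          Power-respects {Φ = Z} (sym (assoc _ _ _))
            (left-multiplication generates (v∈Z zero)
              (absorb-product n (tail v) (λ i → v∈Z (suc i)) y∈Zʳ))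

      generated⊆Zʳ : ∀ {r ℓX} {h : Fin r → Carrier} {X : Pred Carrier ℓX} → Generates h →
        (∀ {x} → X x → Z x) → ∀ {x} → ⟨ X ⟩ x → Power Z r x
      generated⊆Zʳ {r} generates X⊆Z =
        ⟨⟩-least (submonoid⇒subgroup (Zʳ-submonoid generates))
          (λ {x} x∈X → Power-respects {Φ = Z} (identityʳ x)
                         (left-multiplication generates (X⊆Z x∈X) (ε∈Zᵐ r)))

lemma5p6 : {c ℓ ℓX : Level} (Γ : AbelianGroup c ℓ) (p r : ℕ) → Prime p →
    GroupDefs.IsPGroup Γ p → GroupDefs.HasRank Γ r →
    (X : Pred (AbelianGroup.Carrier Γ) ℓX) →
    GroupDefs.IsUnionOfSubgroups Γ X → ∃ X →
    ∀ x → GroupDefs.⟨_⟩ Γ X x → GroupDefs.Power Γ X r x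
-- With Z = CyclicIn X (which equals X), the theorem is ⟨X⟩ ⊆ Z^r ⊆ X^r.
lemma5p6 Γ p r p-prime pgroup ((h , generates) , _) X union@(X-resp , _) (x₀ , x₀∈X) x x∈⟨X⟩
  with GroupTheory.finite-exponent Γ p-prime pgroup generates
... | K , M , p^K≡N , exponent =
  Power-mono {Φ = CyclicIn X} (cyclicIn⇒member X-resp)
    (generated⊆Zʳ generates (union-of-subgroups⇒cyclicIn union) x∈⟨X⟩)
  where
  open GroupTheory Γ
  open WithExponent M exponent
  open Elimination {K = K} p-prime p^K≡N (CyclicIn X) (cyclicIn-pow X-resp)
         (cyclicIn-ε X-resp (union-of-subgroups⇒cyclicIn union x₀∈X))
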